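{- Let $k\geq 4$ and let $N$ be an integer with $F_k<N<F_{k+1}$. Let $c:\{1,\dots,N\}\to\{0,1\}$ be a proper $2$-colouring of $G_N$ with $c(1)=1$. If $N\neq \tfrac{F_{k+2}}{2}$, then $c(N)=c(N-F_k)$. If $N=\tfrac{F_{k+2}}{2}$, then $c(N)=1$ if $k\equiv 1\pmod 6$ and $c(N)=0$ if $k\equiv 4\pmod 6$.
   Context: The Fibonacci numbers are defined by $F_0=0$, $F_1=1$ and $F_m=F_{m-1}+F_{m-2}$ for $m\geq 2$. For each integer $N\geq 1$, the Fibonacci-sum graph $G_N$ is the simple graph with vertex set $\{1,2,\dots,N\}$ in which distinct vertices $i,j$ are adjacent if and only if $i+j$ is a Fibonacci number. Each $G_N$ is bipartite, so a proper $2$-colouring (adjacent vertices receive different colours) exists. -}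

module Defs where

open import Data.Nat using (ℕ; zero; suc; _+_; _≤_)
open import Data.Fin using (Fin)
open import Data.Product using (∃; _×_)
open import Relation.Binary.PropositionalEquality using (_≡_; _≢_)

fib : ℕ → ℕ
fib zero = 0
fib (suc zero) = 1
fib (suc (suc m)) = fib (suc m) + fib m

IsFib : ℕ → Set
IsFib m = ∃ λ j → fib j ≡ m

Adj : ℕ → ℕ → ℕ → Set
Adj N i j = 1 ≤ i × i ≤ N × 1 ≤ j × j ≤ N × i ≢ j × IsFib (i + j)

-- a colouring c : {1..N} → {0,1} (given as a function on ℕ; only values on
-- 1..N matter) is proper for G_N if adjacent vertices get different colours
ProperColouring : ℕ → (ℕ → Fin 2) → Set
ProperColouring N c = ∀ i j → Adj N i j → c i ≢ c j

module Submission where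

-- Both halves of the lemma come from one observation about a
-- proper 2-colouring c of G_N: along a path  i – j – l  of length two the
-- colours of the endpoints agree, because Fin 2 has only two elements
-- (two-step).
--
-- Write q = F_k, p = F_{k-1}, a = F_{k+1} - N and b = N - F_k.
-- Then N + a = F_{k+1} and a + b = F_{k-1} are Fibonacci numbers, so
-- N – a – b is a path unless a = b, i.e. unless 2N = F_{k+2}
-- (reflection-colour).
--
-- The numbers  half t = F_{3t+3} / 2  start at half 0 = 1
-- and consecutive ones sum to F_{3t+5}; they form a Fibonacci chain
-- 1 = half 0 – half 1 – half 2 – …, whose colours alternate (chain-even,
-- chain-odd).  If 2N = F_{k+2} then k ≡ 1 (mod 3), N = half ((k-1)/3), and
-- the parity of (k-1)/3 is decided by k mod 6.

open import Defs
open import Data.Nat using (ℕ; zero; suc; _+_; _*_; _∸_; _≤_; _<_; _%_; _/_; z≤n; s≤s)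
open import Data.Nat.Properties
open import Data.Nat.DivMod using (m≡m%n+[m/n]*n)
open import Data.Nat.Tactic.RingSolver using (solve-∀)
open import Data.Fin using (Fin; zero; suc)
open import Data.Product using (_×_; _,_)
open import Data.Empty using (⊥-elim)
open import Relation.Binary.PropositionalEquality
open ≡-Reasoning

≢-≢⇒≡ : {x y z : Fin 2} → x ≢ y → y ≢ z → x ≡ z
≢-≢⇒≡ {zero}     {zero}     {_}        x≢y _   = ⊥-elim (x≢y refl)
≢-≢⇒≡ {suc zero} {suc zero} {_}        x≢y _   = ⊥-elim (x≢y refl)
≢-≢⇒≡ {_}        {zero}     {zero}     _   y≢z = ⊥-elim (y≢z refl)
≢-≢⇒≡ {_}        {suc zero} {suc zero} _   y≢z = ⊥-elim (y≢z refl)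
≢-≢⇒≡ {zero}     {suc zero} {zero}     _   _   = refl
≢-≢⇒≡ {suc zero} {zero}     {suc zero} _   _   = refl

≢1⇒≡0 : {x : Fin 2} → x ≢ suc zero → x ≡ zero
≢1⇒≡0 {zero}     _   = refl
≢1⇒≡0 {suc zero} x≢1 = ⊥-elim (x≢1 refl)

two-step : {N i j l : ℕ} {c : ℕ → Fin 2} → ProperColouring N c →
           Adj N i j → Adj N j l → c i ≡ c l
two-step {i = i} {j} {l} proper i~j j~l =
  ≢-≢⇒≡ (proper i j i~j) (proper j l j~l)

adj-sym : {N i j : ℕ} → Adj N i j → Adj N j i
adj-sym {i = i} {j} (1≤i , i≤N , 1≤j , j≤N , i≢j , (m , fm≡i+j)) =
  1≤j , j≤N , 1≤i , i≤N , (λ j≡i → i≢j (sym j≡i)) , (m , trans fm≡i+j (+-comm i j))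

edge : {N i j : ℕ} → 1 ≤ i → i < j → j ≤ N → IsFib (i + j) → Adj N i j
edge 1≤i i<j j≤N i+j-fib =
  1≤i , ≤-trans (<⇒≤ i<j) j≤N , ≤-trans 1≤i (<⇒≤ i<j) , j≤N , <⇒≢ i<j , i+j-fib

fib-pos : ∀ n → 1 ≤ fib (suc n)
fib-pos zero    = ≤-refl
fib-pos (suc n) = ≤-trans (fib-pos n) (m≤m+n _ _)

fib-mono : ∀ n → fib n ≤ fib (suc n)
fib-mono zero          = z≤n
fib-mono (suc zero)    = ≤-refl
fib-mono (suc (suc n)) = m≤m+n _ _

-- For Fibonacci numbers p ≤ q whose sum is Fibonacci and
-- q < N < q + p, the vertices a = (q + p) - N and b = N - q satisfy
-- N + a = q + p and a + b = p; unless a = b (i.e. 2N = 2q + p) this gives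
-- the path N – a – b, hence c N = c b.
reflection-colour : (N p q : ℕ) (c : ℕ → Fin 2) → ProperColouring N c →
  IsFib p → IsFib (q + p) → p ≤ q → q < N → N < q + p →
  2 * N ≢ (q + p) + q → c N ≡ c (N ∸ q)
reflection-colour N p q c proper (m , fm≡p) (m' , fm'≡q+p) p≤q q<N N<q+p 2N≢ =
  two-step proper (adj-sym N~a) a~b
  where
  a = (q + p) ∸ N
  b = N ∸ q
  q+b≡N : q + b ≡ N
  q+b≡N = m+[n∸m]≡n (<⇒≤ q<N)
  N+a≡q+p : N + a ≡ q + p
  N+a≡q+p = m+[n∸m]≡n (<⇒≤ N<q+p)
  a+b≡p : a + b ≡ p
  a+b≡p = +-cancelˡ-≡ q _ _ (begin
    q + (a + b)  ≡⟨ cong (q +_) (+-comm a b) ⟩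
    q + (b + a)  ≡⟨ +-assoc q b a ⟨
    q + b + a    ≡⟨ cong (_+ a) q+b≡N ⟩
    N + a        ≡⟨ N+a≡q+p ⟩
    q + p        ∎)
  1≤a : 1 ≤ a
  1≤a = m<n⇒0<n∸m N<q+p
  1≤b : 1 ≤ b
  1≤b = m<n⇒0<n∸m q<N
  a<N : a < N
  a<N = ≤-trans (≤-trans (m<m+n a 1≤b) (≤-reflexive a+b≡p)) (≤-trans p≤q (<⇒≤ q<N))
  a≢b : a ≢ b
  a≢b a≡b = 2N≢ (begin
    2 * N            ≡⟨ cong (N +_) (+-identityʳ N) ⟩
    N + N            ≡⟨ cong (N +_) (sym q+b≡N) ⟩
    N + (q + b)      ≡⟨ cong (λ x → N + (q + x)) (sym a≡b) ⟩
    N + (q + a)      ≡⟨ cong (N +_) (+-comm q a) ⟩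
    N + (a + q)      ≡⟨ +-assoc N a q ⟨
    N + a + q        ≡⟨ cong (_+ q) N+a≡q+p ⟩
    q + p + q        ∎)
  N~a : Adj N a N
  N~a = edge 1≤a a<N ≤-refl (m' , trans fm'≡q+p (trans (sym N+a≡q+p) (+-comm N a)))
  a~b : Adj N a b
  a~b = 1≤a , <⇒≤ a<N , 1≤b , m∸n≤m N q , a≢b , (m , trans fm≡p (sym a+b≡p))

record FibChain (v : ℕ → ℕ) : Set where
  field
    starts-positive : 1 ≤ v 0
    increasing      : ∀ t → v t < v (suc t)
    consecutive-fib : ∀ t → IsFib (v t + v (suc t))

module _ {v : ℕ → ℕ} (chain : FibChain v) {N : ℕ} {c : ℕ → Fin 2}
         (proper : ProperColouring N c) where
  open FibChain chain

  chain-positive : ∀ t → 1 ≤ v t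
  chain-positive zero    = starts-positive
  chain-positive (suc t) = ≤-trans (chain-positive t) (<⇒≤ (increasing t))

  chain-edge : ∀ t → v (suc t) ≤ N → Adj N (v t) (v (suc t))
  chain-edge t v≤N = edge (chain-positive t) (increasing t) v≤N (consecutive-fib t)

  chain-even : ∀ m → v (m * 2) ≤ N → c (v (m * 2)) ≡ c (v 0)
  chain-even zero    _   = refl
  chain-even (suc m) v≤N = begin
    c (v (suc m * 2))  ≡⟨ two-step proper (adj-sym (chain-edge (suc (m * 2)) v≤N))
                                          (adj-sym (chain-edge (m * 2) v₁≤N)) ⟩
    c (v (m * 2))      ≡⟨ chain-even m (≤-trans (<⇒≤ (increasing (m * 2))) v₁≤N) ⟩
    c (v 0)            ∎
    where
    v₁≤N : v (suc (m * 2)) ≤ N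
    v₁≤N = ≤-trans (<⇒≤ (increasing (suc (m * 2)))) v≤N

  chain-odd : ∀ m → v (suc (m * 2)) ≤ N → c (v (suc (m * 2))) ≢ c (v 0)
  chain-odd m v≤N same = proper (v (m * 2)) (v (suc (m * 2))) (chain-edge (m * 2) v≤N)
    (trans (chain-even m (≤-trans (<⇒≤ (increasing (m * 2))) v≤N)) (sym same))

-- half t = F_{3t+3} / 2 (every third Fibonacci number is even).
half : ℕ → ℕ
half zero    = 1
half (suc t) = fib (4 + 3 * t) + half t

double-half : ∀ t → 2 * half t ≡ fib (3 + 3 * t)
double-half zero    = refl
double-half (suc t) = begin
  2 * (F₄ + half t)          ≡⟨ doubling F₄ (half t) ⟩
  F₄ + 2 * half t + F₄       ≡⟨ cong (λ x → F₄ + x + F₄) (double-half t) ⟩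
  fib (6 + 3 * t)            ≡⟨ cong fib (index t) ⟩
  fib (3 + 3 * suc t)        ∎
  where
  F₄ = fib (4 + 3 * t)
  doubling : ∀ x y → 2 * (x + y) ≡ x + 2 * y + x
  doubling = solve-∀
  index : ∀ t → 6 + 3 * t ≡ 3 + 3 * suc t
  index = solve-∀

half-chain : FibChain half
half-chain = record
  { starts-positive = ≤-refl
  ; increasing      = λ t → +-monoˡ-≤ (half t) (fib-pos (3 + 3 * t))
  ; consecutive-fib = λ t → 5 + 3 * t , sum-of-halves t
  }
  where
  sum-of-halves : ∀ t → fib (5 + 3 * t) ≡ half t + half (suc t)
  sum-of-halves t = begin
    F₄ + fib (3 + 3 * t)       ≡⟨ cong (F₄ +_) (double-half t) ⟨
    F₄ + 2 * half t            ≡⟨ regroup F₄ (half t) ⟩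
    half t + (F₄ + half t)     ∎
    where
    F₄ = fib (4 + 3 * t)
    regroup : ∀ x y → x + 2 * y ≡ y + (x + y)
    regroup = solve-∀

half-of-fib : ∀ N t → 2 * N ≡ fib (3 + 3 * t) → N ≡ half t
half-of-fib N t 2N≡ = *-cancelˡ-≡ N (half t) 2 (trans 2N≡ (sym (double-half t)))

index-mod-1 : ∀ k → k % 6 ≡ 1 → k + 2 ≡ 3 + 3 * (k / 6 * 2)
index-mod-1 k k%6≡1 = begin
  k + 2                    ≡⟨ cong (_+ 2) (trans (m≡m%n+[m/n]*n k 6) (cong (_+ k / 6 * 6) k%6≡1)) ⟩
  1 + k / 6 * 6 + 2        ≡⟨ regroup (k / 6) ⟩
  3 + 3 * (k / 6 * 2)      ∎
  where
  regroup : ∀ q → 1 + q * 6 + 2 ≡ 3 + 3 * (q * 2)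
  regroup = solve-∀

index-mod-4 : ∀ k → k % 6 ≡ 4 → k + 2 ≡ 3 + 3 * suc (k / 6 * 2)
index-mod-4 k k%6≡4 = begin
  k + 2                    ≡⟨ cong (_+ 2) (trans (m≡m%n+[m/n]*n k 6) (cong (_+ k / 6 * 6) k%6≡4)) ⟩
  4 + k / 6 * 6 + 2        ≡⟨ regroup (k / 6) ⟩
  3 + 3 * suc (k / 6 * 2)  ∎
  where
  regroup : ∀ q → 4 + q * 6 + 2 ≡ 3 + 3 * suc (q * 2)
  regroup = solve-∀

lemma5 : (k N : ℕ) → 4 ≤ k → fib k < N → N < fib (k + 1) →
         (c : ℕ → Fin 2) → ProperColouring N c → c 1 ≡ suc zero →
         (2 * N ≢ fib (k + 2) → c N ≡ c (N ∸ fib k)) ×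
         (2 * N ≡ fib (k + 2) →
            (k % 6 ≡ 1 → c N ≡ suc zero) × (k % 6 ≡ 4 → c N ≡ zero))
lemma5 k@(suc j) N (s≤s _) Fk<N N<Fk+1 c proper c1≡1 = generic , exceptional
  where
  -- p = F_{k-1}, q = F_k; fib (k + 1) = q + p and fib (k + 2) = (q + p) + q.
  generic : 2 * N ≢ fib (k + 2) → c N ≡ c (N ∸ fib k)
  generic 2N≢ = reflection-colour N (fib j) (fib k) c proper (j , refl) (suc k , refl)
    (fib-mono j) Fk<N (subst (N <_) (cong fib (+-comm k 1)) N<Fk+1)
    (λ 2N≡ → 2N≢ (trans 2N≡ (cong fib (+-comm 2 k))))
  exceptional : 2 * N ≡ fib (k + 2) →
                (k % 6 ≡ 1 → c N ≡ suc zero) × (k % 6 ≡ 4 → c N ≡ zero)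
  exceptional 2N≡ = colour-1 , colour-4
    where
    colour-1 : k % 6 ≡ 1 → c N ≡ suc zero
    colour-1 k%6≡1 = begin
      c N                    ≡⟨ cong c N≡half ⟩
      c (half (k / 6 * 2))   ≡⟨ chain-even half-chain proper (k / 6) (≤-reflexive (sym N≡half)) ⟩
      c 1                    ≡⟨ c1≡1 ⟩
      suc zero               ∎
      where
      N≡half : N ≡ half (k / 6 * 2)
      N≡half = half-of-fib N (k / 6 * 2) (trans 2N≡ (cong fib (index-mod-1 k k%6≡1)))
    colour-4 : k % 6 ≡ 4 → c N ≡ zero
    colour-4 k%6≡4 = ≢1⇒≡0 λ cN≡1 →
      chain-odd half-chain proper (k / 6) (≤-reflexive (sym N≡half))
        (trans (sym (cong c N≡half)) (trans cN≡1 (sym c1≡1)))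
      where
      N≡half : N ≡ half (suc (k / 6 * 2))
      N≡half = half-of-fib N (suc (k / 6 * 2)) (trans 2N≡ (cong fib (index-mod-4 k k%6≡4)))
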